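{- Let $\mathcal F$ be a finite set of graphs and let $\mathrm{Forb}(\mathcal F)$ be the class of all graphs $G$ such that no induced subgraph of $G$ is isomorphic to a graph in $\mathcal F$. Then $\mathrm{Forb}(\mathcal F)$ can be decided by a query algorithm.
   Context: Graphs are finite, simple, undirected, with non-empty vertex set; classes are closed under isomorphism. For graphs $F,G$, $\hom(F,G)$ is the number of homomorphisms from $F$ to $G$. A class $\mathcal C$ has a hom algorithm if there are $k\ge1$, graphs $F_1,\dots,F_k$ and a set $X\subseteq\mathbb N^k$ such that for every graph $G$: $G\in\mathcal C\iff(\hom(F_1,G),\dots,\hom(F_k,G))\in X$. Emb, s-hom and s-emb algorithms are defined analogously using the numbers of injective homomorphisms, of strong homomorphisms ($uv\in E(F)\iff f(u)f(v)\in E(G)$), and of injective strong homomorphisms. A class has a query algorithm if it has an algorithm of one (equivalently, each) of these four types. -}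

module Defs where

open import Data.Nat using (ℕ; zero; suc; _≤_)
open import Data.Bool using (Bool; true; false)
open import Data.Fin using (Fin)
open import Data.Fin.Properties using (all?) renaming (_≟_ to _≟ᶠ_)
open import Data.Bool.Properties using () renaming (_≟_ to _≟ᵇ_)
open import Data.List using (List; []; _∷_; map; concatMap; length; filter)
open import Data.List.Membership.Propositional using (_∈_)
open import Data.Vec using (Vec)
import Data.Vec as V
open import Data.Vec.Functional using () renaming (_∷_ to _∷ᶠ_)
open import Data.Product using (Σ; _×_; _,_; ∃)
open import Data.Sum using (_⊎_)
open import Function using (Injective; Inverseᵇ; _⇔_)
open import Relation.Nullary using (¬_; Dec)
open import Relation.Nullary.Decidable using (_→-dec_; _×-dec_)
open import Relation.Binary.PropositionalEquality using (_≡_)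

record Graph : Set where
  field
    n        : ℕ
    nonEmpty : 1 ≤ n
    adj      : Fin n → Fin n → Bool
    sym      : ∀ i j → adj i j ≡ adj j i
    irrefl   : ∀ i → adj i i ≡ false
open Graph public

allFuns : (m k : ℕ) → List (Fin m → Fin k)
allFuns zero    k = (λ ()) ∷ []
allFuns (suc m) k =
  concatMap (λ f → map (λ x → x ∷ᶠ f) (V.toList (V.allFin k))) (allFuns m k)

module _ (F G : Graph) where
  IsHom : (Fin (n F) → Fin (n G)) → Set
  IsHom f = ∀ i j → adj F i j ≡ true → adj G (f i) (f j) ≡ true

  IsStrongHom : (Fin (n F) → Fin (n G)) → Set
  IsStrongHom f = ∀ i j → adj F i j ≡ adj G (f i) (f j)

  IsInj : (Fin (n F) → Fin (n G)) → Set
  IsInj f = ∀ i j → f i ≡ f j → i ≡ j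

  isHom? : ∀ f → Dec (IsHom f)
  isHom? f = all? λ i → all? λ j → (adj F i j ≟ᵇ true) →-dec (adj G (f i) (f j) ≟ᵇ true)

  isStrongHom? : ∀ f → Dec (IsStrongHom f)
  isStrongHom? f = all? λ i → all? λ j → adj F i j ≟ᵇ adj G (f i) (f j)

  isInj? : ∀ f → Dec (IsInj f)
  isInj? f = all? λ i → all? λ j → (f i ≟ᶠ f j) →-dec (i ≟ᶠ j)

  hom : ℕ
  hom = length (filter isHom? (allFuns (n F) (n G)))

  emb : ℕ
  emb = length (filter (λ f → isHom? f ×-dec isInj? f) (allFuns (n F) (n G)))

  shom : ℕ
  shom = length (filter isStrongHom? (allFuns (n F) (n G)))

  semb : ℕ
  semb = length (filter (λ f → isStrongHom? f ×-dec isInj? f) (allFuns (n F) (n G)))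

  record Iso : Set where
    field
      to      : Fin (n F) → Fin (n G)
      from    : Fin (n G) → Fin (n F)
      inverse : Inverseᵇ _≡_ _≡_ to from
      preserv : ∀ i j → adj F i j ≡ adj G (to i) (to j)

-- The induced subgraph of G on a non-empty vertex subset, given as the image of an
-- injective map ι : Fin m → V(G) (vertices relabelled by Fin m).
inducedOn : (G : Graph) (m : ℕ) → 1 ≤ m → (ι : Fin m → Fin (n G)) → Graph
inducedOn G m p ι = record
  { n = m ; nonEmpty = p
  ; adj = λ i j → adj G (ι i) (ι j)
  ; sym = λ i j → sym G (ι i) (ι j)
  ; irrefl = λ i → irrefl G (ι i) }

HasInducedCopy : Graph → Graph → Set
HasInducedCopy G H =
  Σ ℕ λ m → Σ (1 ≤ m) λ p → Σ (Fin m → Fin (n G)) λ ι →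
    Injective _≡_ _≡_ ι × Iso H (inducedOn G m p ι)

Forb : List Graph → Graph → Set
Forb 𝓕 G = ∀ H → H ∈ 𝓕 → ¬ HasInducedCopy G H

GraphClass : Set₁
GraphClass = Graph → Set

CountAlgorithm : (Graph → Graph → ℕ) → GraphClass → Set₁
CountAlgorithm cnt 𝓒 =
  Σ ℕ λ k → 1 ≤ k × Σ (Vec Graph k) λ Fs → Σ (Vec ℕ k → Set) λ X →
    ∀ G → (𝓒 G ⇔ X (V.map (λ F → cnt F G) Fs))

HomAlgorithm SHomAlgorithm EmbAlgorithm SEmbAlgorithm : GraphClass → Set₁
HomAlgorithm  = CountAlgorithm hom
EmbAlgorithm  = CountAlgorithm emb
SHomAlgorithm = CountAlgorithm shom
SEmbAlgorithm = CountAlgorithm semb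

QueryAlgorithm : GraphClass → Set₁
QueryAlgorithm 𝓒 = HomAlgorithm 𝓒 ⊎ EmbAlgorithm 𝓒 ⊎ SHomAlgorithm 𝓒 ⊎ SEmbAlgorithm 𝓒

-- A graph G avoids H as an induced subgraph iff there is no injective strong
-- homomorphism H → G, i.e. iff semb(H, G) = 0.  So membership in Forb(𝓕) is
-- read off the vector (semb(H, G))_{H ∈ 𝓕}: G ∈ Forb(𝓕) iff it is zero.
module Submission where

open import Defs
open import Data.Nat using (ℕ; zero; suc; s≤s; z≤n)
open import Data.Bool using (false)
open import Data.Fin using (Fin)
import Data.Fin as Fin
open import Data.List using (List; map; length; filter)
open import Data.List.Relation.Unary.Any using (Any; here)
import Data.List.Relation.Unary.Any as Any
open import Data.List.Relation.Unary.All as All using (All)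
open import Data.List.Relation.Unary.Any.Properties using (concatMap⁺)
open import Data.List.Membership.Propositional.Properties using (∈-map⁺)
open import Data.List.Properties using (filter-some; filter-none)
open import Data.List.Relation.Unary.All.Properties using (¬Any⇒All¬)
open import Data.Nat.Properties using (<⇒≢)
open import Data.Vec using (Vec; fromList; toList; allFin; tail)
import Data.Vec as Vec
import Data.Vec.Relation.Unary.All as VecAll
import Data.Vec.Relation.Unary.All.Properties as VecAll
open import Data.Vec.Membership.Propositional.Properties using (∈-allFin⁺; ∈-toList⁺)
open import Data.Vec.Functional using () renaming (_∷_ to _∷ᶠ_)
open import Data.Product using (∃; _×_; _,_; proj₂)
open import Data.Sum using (inj₂)
open import Function using (_∘_; _⇔_; mk⇔; Equivalence)
open import Function.Properties.Equivalence using () renaming (trans to ⇔-trans; sym to ⇔-sym)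
open import Function.Consequences.Propositional using (inverseʳ⇒injective)
open import Relation.Nullary using (¬_)
open import Relation.Nullary.Negation using (contraposition)
open import Relation.Nullary.Decidable using (_×-dec_)
open import Relation.Unary using (Decidable)
open import Relation.Binary.PropositionalEquality using (_≡_; _≗_; refl; cong; cong₂)
import Relation.Binary.PropositionalEquality as ≡

¬-cong-⇔ : ∀ {A B : Set} → A ⇔ B → (¬ A) ⇔ (¬ B)
¬-cong-⇔ A⇔B = mk⇔ (contraposition (Equivalence.from A⇔B)) (contraposition (Equivalence.to A⇔B))

length-filter≡0⇔¬Any : ∀ {A : Set} {P : A → Set} (P? : Decidable P) (xs : List A) →
                       length (filter P? xs) ≡ 0 ⇔ (¬ Any P xs)
length-filter≡0⇔¬Any P? xs = mk⇔
  (λ len≡0 any → <⇒≢ (filter-some P? any) (≡.sym len≡0))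
  (λ ¬any → cong length (filter-none P? (¬Any⇒All¬ xs ¬any)))

allFuns-complete : ∀ m k (f : Fin m → Fin k) → Any (_≗ f) (allFuns m k)
allFuns-complete zero    k f = here (λ ())
allFuns-complete (suc m) k f =
  concatMap⁺ _ (Any.map extend (allFuns-complete m k (f ∘ Fin.suc)))
  where
  extend : ∀ {g} → g ≗ f ∘ Fin.suc →
           Any (_≗ f) (map (_∷ᶠ g) (toList (allFin k)))
  extend {g} g≗ = Any.map (λ { refl → pointwise })
                          (∈-map⁺ (_∷ᶠ g) (∈-toList⁺ (∈-allFin⁺ (f Fin.zero))))
    where
    pointwise : (f Fin.zero ∷ᶠ g) ≗ f
    pointwise Fin.zero    = refl
    pointwise (Fin.suc i) = g≗ i

-- allFuns lists each function only up to ≗ (there is no function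
-- extensionality), hence the invariance hypothesis on P.
any-allFuns⇔∃ : ∀ {m k} {P : (Fin m → Fin k) → Set} →
                (∀ {f g} → f ≗ g → P f → P g) → Any P (allFuns m k) ⇔ ∃ P
any-allFuns⇔∃ {m} {k} P-resp-≗ = mk⇔ Any.satisfied λ (f , Pf) →
  Any.map (λ g≗f → P-resp-≗ (≡.sym ∘ g≗f) Pf) (allFuns-complete m k f)

IsInducedEmbedding : (H G : Graph) → (Fin (n H) → Fin (n G)) → Set
IsInducedEmbedding H G f = IsStrongHom H G f × IsInj H G f

isInducedEmbedding? : (H G : Graph) → Decidable (IsInducedEmbedding H G)
isInducedEmbedding? H G f = isStrongHom? H G f ×-dec isInj? H G f

module _ (H G : Graph) where

  isInducedEmbedding-resp-≗ : ∀ {f g} → f ≗ g →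
                              IsInducedEmbedding H G f → IsInducedEmbedding H G g
  isInducedEmbedding-resp-≗ {f} {g} f≗g (strong , inj) =
    (λ i j → ≡.trans (strong i j) (cong₂ (adj G) (f≗g i) (f≗g j))) ,
    (λ i j gi≡gj → inj i j (≡.trans (f≗g i) (≡.trans gi≡gj (≡.sym (f≗g j)))))

  hasInducedCopy⇔inducedEmbedding : HasInducedCopy G H ⇔ ∃ (IsInducedEmbedding H G)
  hasInducedCopy⇔inducedEmbedding = mk⇔ copy⇒embedding embedding⇒copy
    where
    copy⇒embedding : HasInducedCopy G H → ∃ (IsInducedEmbedding H G)
    copy⇒embedding (_ , _ , ι , ι-inj , iso) =
      ι ∘ to , preserv , λ i j → inverseʳ⇒injective to (proj₂ inverse) ∘ ι-inj
      where open Iso iso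

    embedding⇒copy : ∃ (IsInducedEmbedding H G) → HasInducedCopy G H
    embedding⇒copy (f , strong , inj) =
      n H , nonEmpty H , f , (λ {i} {j} → inj i j) ,
      record { to = λ i → i ; from = λ i → i
             ; inverse = (λ i≡j → i≡j) , (λ i≡j → i≡j) ; preserv = strong }

semb≡0⇔noInducedCopy : (H G : Graph) → semb H G ≡ 0 ⇔ (¬ HasInducedCopy G H)
semb≡0⇔noInducedCopy H G =
  ⇔-trans (length-filter≡0⇔¬Any (isInducedEmbedding? H G) (allFuns (n H) (n G)))
          (¬-cong-⇔ (⇔-trans (any-allFuns⇔∃ (isInducedEmbedding-resp-≗ H G))
                             (⇔-sym (hasInducedCopy⇔inducedEmbedding H G))))

forb⇔all-semb≡0 : (𝓕 : List Graph) (G : Graph) → Forb 𝓕 G ⇔ All (λ H → semb H G ≡ 0) 𝓕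
forb⇔all-semb≡0 𝓕 G = mk⇔
  (λ forb → All.tabulate λ {H} H∈𝓕 →
     Equivalence.from (semb≡0⇔noInducedCopy H G) (forb H H∈𝓕))
  (λ zeros H H∈𝓕 → Equivalence.to (semb≡0⇔noInducedCopy H G) (All.lookup zeros H∈𝓕))

K₁ : Graph
K₁ = record { n = 1 ; nonEmpty = s≤s z≤n ; adj = λ _ _ → false
            ; sym = λ _ _ → refl ; irrefl = λ _ → refl }

-- The first query (K₁) is a dummy: it only ensures k ≥ 1 when 𝓕 is empty.
ZeroAfterHead : ∀ {k} → Vec ℕ (suc k) → Set
ZeroAfterHead counts = VecAll.All (_≡ 0) (tail counts)

lemma4p1 : (𝓕 : List Graph) → QueryAlgorithm (Forb 𝓕)
lemma4p1 𝓕 = inj₂ (inj₂ (inj₂ (suc (length 𝓕) , s≤s z≤n , K₁ Vec.∷ fromList 𝓕 ,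
                                ZeroAfterHead , decides)))
  where
  decides : ∀ G → Forb 𝓕 G ⇔ ZeroAfterHead (Vec.map (λ F → semb F G) (K₁ Vec.∷ fromList 𝓕))
  decides G = ⇔-trans (forb⇔all-semb≡0 𝓕 G)
                      (mk⇔ (VecAll.map⁺ ∘ VecAll.fromList⁺) (VecAll.fromList⁻ ∘ VecAll.map⁻))
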